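{- Let $K_n^+$ denote the complete graph $K_n$ with all edges signed $+1$ and $K_n^-$ the complete graph $K_n$ with all edges signed $-1$. Then $\dim(K_n^+)=\dim(K_n^-)=n-1$.
   Context: A signed graph is $(G,\sigma)$ with $\sigma:E(G)\to\{+1,-1\}$. For a signed graph in which all shortest paths between any two vertices have the same sign (here: every signed complete graph), the signed distance is $d_\Sigma(u,v)=\sigma(uv)d(u,v)$ where $\sigma(uv)$ is the sign (product of edge signs) of a shortest $u$–$v$ path and $d$ is the graph distance. For an ordered vertex set $W=(w_1,\dots,w_k)$, $r(v|W)=(d_\Sigma(v,w_1),\dots,d_\Sigma(v,w_k))$; $W$ is resolving if distinct vertices have distinct representations; $\dim$ is the minimum cardinality of a resolving set. -}

module Defs where

open import Data.Nat using (ℕ; _≤_; _∸_)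
open import Data.Fin using (Fin; _≟_)
open import Data.Integer using (ℤ; _◃_)
open import Data.Sign using (Sign)
open import Data.List using (List; map; length)
open import Data.List.Relation.Unary.Unique.Propositional using (Unique)
open import Data.Product using (Σ; _×_)
open import Relation.Binary.PropositionalEquality using (_≡_)
open import Relation.Nullary using (yes; no)

-- A signed complete graph on vertex set Fin n: a sign for every pair of vertices
-- (only values at distinct pairs matter; symmetric).
record SignedComplete (n : ℕ) : Set where
  field
    σ    : Fin n → Fin n → Sign
    symm : ∀ u v → σ u v ≡ σ v u

dist : ∀ {n} → Fin n → Fin n → ℕ
dist u v with u ≟ v
... | yes _ = 0
... | no  _ = 1

-- signed distance: (sign of the unique shortest path) * distance.
-- For u ≢ v the shortest path is the edge uv; for u ≡ v the distance is 0.
signedDist : ∀ {n} → SignedComplete n → Fin n → Fin n → ℤ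
signedDist G u v = SignedComplete.σ G u v ◃ dist u v

Kplus : (n : ℕ) → SignedComplete n
Kplus n = record { σ = λ _ _ → Sign.+ ; symm = λ _ _ → Relation.Binary.PropositionalEquality.refl }

Kminus : (n : ℕ) → SignedComplete n
Kminus n = record { σ = λ _ _ → Sign.- ; symm = λ _ _ → Relation.Binary.PropositionalEquality.refl }

rep : ∀ {n} → SignedComplete n → List (Fin n) → Fin n → List ℤ
rep G W v = map (signedDist G v) W

Resolving : ∀ {n} → SignedComplete n → List (Fin n) → Set
Resolving G W = ∀ u v → rep G W u ≡ rep G W v → u ≡ v

IsDim : ∀ {n} → SignedComplete n → ℕ → Set
IsDim {n} G k =
  Σ (List (Fin n)) (λ W → Unique W × Resolving G W × length W ≡ k)
  × (∀ (W : List (Fin n)) → Unique W → Resolving G W → k ≤ length W)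

{-# OPTIONS --safe #-}
module Submission where

-- In any signed complete graph a vertex is the only one at signed distance 0
-- from itself, so every vertex set missing a single vertex is resolving.
-- When all edges carry the same sign, every vertex outside W is at signed
-- distance ±1 from each member of W, so all of them share one representation;
-- a resolving W therefore misses at most one vertex.

open import Defs
open import Data.Nat using (ℕ; zero; suc; _∸_; _≤_)
open import Data.Nat.Properties using (∸-monoˡ-≤)
open import Data.Product using (Σ; _×_; _,_; proj₁; proj₂)
open import Data.Fin as Fin using (Fin; _≟_; inject₁; fromℕ)
open import Data.Fin.Properties using (suc-injective; inject₁-injective; fromℕ≢inject₁; injective⇒≤)
open import Data.Integer using (_◃_; +_)
open import Data.Sign using (Sign)
open import Data.List using (List; []; _∷_; map; length; tabulate; lookup)
open import Data.List.Properties using (∷-injective; length-tabulate)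
open import Data.List.Relation.Unary.Any using (here; there; index)
open import Data.List.Relation.Unary.Any.Properties using (lookup-index)
open import Data.List.Membership.Propositional using (_∈_; _∉_)
open import Data.List.Membership.Propositional.Properties using (∈-tabulate⁺)
open import Data.List.Relation.Unary.Unique.Propositional using (Unique; [])
open import Data.List.Relation.Unary.Unique.Propositional.Properties using (tabulate⁺)
open import Function using (_∘_)
open import Function.Definitions using (Injective)
open import Relation.Binary.PropositionalEquality
open import Relation.Nullary using (yes; no; contradiction)

module _ {n : ℕ} (G : SignedComplete n) where

  signedDist-refl : ∀ u → signedDist G u u ≡ + 0
  signedDist-refl u with u ≟ u
  ... | yes _   = refl
  ... | no u≢u = contradiction refl u≢u

  signedDist≡0⇒≡ : ∀ {u v} → signedDist G u v ≡ + 0 → u ≡ v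
  signedDist≡0⇒≡ {u} {v} eq with u ≟ v | SignedComplete.σ G u v
  ... | yes u≡v | _      = u≡v
  ... | no _    | Sign.- = contradiction eq λ ()
  ... | no _    | Sign.+ = contradiction eq λ ()

  rep-≡⇒signedDist-≡ : ∀ {W u v x} → x ∈ W → rep G W u ≡ rep G W v →
                       signedDist G u x ≡ signedDist G v x
  rep-≡⇒signedDist-≡ (here refl) eq = proj₁ (∷-injective eq)
  rep-≡⇒signedDist-≡ {_ ∷ W} (there x∈W) eq =
    rep-≡⇒signedDist-≡ {W} x∈W (proj₂ (∷-injective eq))

  rep-≡⇒≡-of-∈ : ∀ {W u v} → u ∈ W → rep G W u ≡ rep G W v → u ≡ v
  rep-≡⇒≡-of-∈ {u = u} u∈W eq = sym (signedDist≡0⇒≡ (begin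
    signedDist G _ u  ≡⟨ rep-≡⇒signedDist-≡ u∈W eq ⟨
    signedDist G u u  ≡⟨ signedDist-refl u ⟩
    + 0               ∎))
    where open ≡-Reasoning

allButZero-resolving : ∀ {m} (G : SignedComplete (suc m)) → Resolving G (tabulate Fin.suc)
allButZero-resolving G Fin.zero    Fin.zero    _  = refl
allButZero-resolving G (Fin.suc a) v           eq = rep-≡⇒≡-of-∈ G (∈-tabulate⁺ a) eq
allButZero-resolving G u           (Fin.suc b) eq = sym (rep-≡⇒≡-of-∈ G (∈-tabulate⁺ b) (sym eq))

resolving-of-length-n∸1 : ∀ {n} (G : SignedComplete n) →
  Σ (List (Fin n)) (λ W → Unique W × Resolving G W × length W ≡ n ∸ 1)
resolving-of-length-n∸1 {zero}  G = [] , [] , (λ ()) , refl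
resolving-of-length-n∸1 {suc m} G =
  tabulate Fin.suc , tabulate⁺ suc-injective , allButZero-resolving G , length-tabulate Fin.suc

module _ {n : ℕ} (G : SignedComplete n) {c : Sign}
         (uniform : ∀ u v → SignedComplete.σ G u v ≡ c) where

  open import Data.List.Membership.DecPropositional (_≟_ {n}) using (_∈?_)

  signedDist-≢ : ∀ {u v} → u ≢ v → signedDist G u v ≡ c ◃ 1
  signedDist-≢ {u} {v} u≢v with u ≟ v
  ... | yes u≡v = contradiction u≡v u≢v
  ... | no _    = cong (_◃ 1) (uniform u v)

  rep-∉ : ∀ {W u} → u ∉ W → rep G W u ≡ map (λ _ → c ◃ 1) W
  rep-∉ {[]}    u∉W = refl
  rep-∉ {w ∷ W} u∉W = cong₂ _∷_ (signedDist-≢ (u∉W ∘ here)) (rep-∉ (u∉W ∘ there))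

  slot : (W : List (Fin n)) → Fin n → Fin (suc (length W))
  slot W v with v ∈? W
  ... | yes v∈W = inject₁ (index v∈W)
  ... | no _    = fromℕ (length W)

  slot-injective : ∀ {W} → Resolving G W → Injective _≡_ _≡_ (slot W)
  slot-injective {W} res {u} {v} eq with u ∈? W | v ∈? W
  ... | yes u∈W | yes v∈W = begin
    u                       ≡⟨ lookup-index u∈W ⟩
    lookup W (index u∈W)    ≡⟨ cong (lookup W) (inject₁-injective eq) ⟩
    lookup W (index v∈W)    ≡⟨ lookup-index v∈W ⟨
    v                       ∎
    where open ≡-Reasoning
  ... | yes _   | no _    = contradiction (sym eq) fromℕ≢inject₁
  ... | no _    | yes _   = contradiction eq fromℕ≢inject₁
  ... | no u∉W  | no v∉W  = res u v (trans (rep-∉ u∉W) (sym (rep-∉ v∉W)))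

  resolving⇒n∸1≤length : ∀ {W} → Resolving G W → n ∸ 1 ≤ length W
  resolving⇒n∸1≤length res = ∸-monoˡ-≤ 1 (injective⇒≤ (slot-injective res))

  isDim-uniform : IsDim G (n ∸ 1)
  isDim-uniform = resolving-of-length-n∸1 G , λ _ _ → resolving⇒n∸1≤length

corollary2p4 : ∀ (n : ℕ) → IsDim (Kplus n) (n ∸ 1) × IsDim (Kminus n) (n ∸ 1)
corollary2p4 n = isDim-uniform (Kplus n) (λ _ _ → refl) , isDim-uniform (Kminus n) (λ _ _ → refl)
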